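{- Let $n\geq 6$ and let $i$ be an integer with $\lfloor n/3\rfloor+2\leq i\leq \lfloor n/2\rfloor$. Then $$d_a(C_n,i)\leq \sum_{k=3}^{i-1} n\,d(P_{n-k-2},i-k).$$
   Context: $C_n$ denotes the cycle on $n$ vertices and $P_m$ the path on $m$ vertices. A dominating set of a graph $G=(V,E)$ is a set $D\subseteq V$ such that every vertex not in $D$ is adjacent to some vertex of $D$. A dominating set $D$ is accurate if no $|D|$-element subset of $V\setminus D$ is a dominating set of $G$. $d(G,j)$ is the number of dominating sets of $G$ of cardinality $j$ and $d_a(G,j)$ the number of accurate dominating sets of $G$ of cardinality $j$. Empty sums are $0$. -}

module Defs where

open import Data.Nat using (ℕ; zero; suc; _+_; _*_; _∸_; _≡ᵇ_; _/_; _%_)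
open import Data.Bool using (Bool; true; false; _∧_; _∨_; not; if_then_else_)
open import Data.Fin using (Fin; toℕ)
open import Data.Fin.Subset using (Subset; ∣_∣)
open import Data.Vec using (Vec; []; _∷_; lookup)
open import Data.List using (List; []; _∷_; map; _++_; length; upTo; allFin)
open import Data.Bool.ListAction using (all; any)
open import Data.Nat.ListAction using (sum)
open import Data.List using () renaming (filterᵇ to filterB)

Graph : ℕ → Set
Graph n = Fin n → Fin n → Bool

-- Cycle C_n on vertices 0..n-1: i ~ j iff j ≡ i+1 (mod n) or i ≡ j+1 (mod n).
-- (Only used for n ≥ 6, where this is the usual simple cycle.)
cycleG : (n : ℕ) → Graph n
cycleG (suc n) i j =
  (toℕ j ≡ᵇ ((suc (toℕ i)) % suc n)) ∨ (toℕ i ≡ᵇ ((suc (toℕ j)) % suc n))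
cycleG zero ()

pathG : (m : ℕ) → Graph m
pathG m i j = (toℕ j ≡ᵇ suc (toℕ i)) ∨ (toℕ i ≡ᵇ suc (toℕ j))

allSubsets : (n : ℕ) → List (Subset n)
allSubsets zero = [] ∷ []
allSubsets (suc n) = map (true ∷_) (allSubsets n) ++ map (false ∷_) (allSubsets n)

isDominating : ∀ {n} → Graph n → Subset n → Bool
isDominating {n} G D =
  all (λ v → lookup D v ∨ any (λ u → lookup D u ∧ G u v) (allFin n)) (allFin n)

disjointFrom : ∀ {n} → Subset n → Subset n → Bool
disjointFrom {n} S D = all (λ v → not (lookup S v ∧ lookup D v)) (allFin n)

isAccurate : ∀ {n} → Graph n → Subset n → Bool
isAccurate {n} G D =
  isDominating G D ∧
  not (any (λ S → disjointFrom S D ∧ (∣ S ∣ ≡ᵇ ∣ D ∣) ∧ isDominating G S) (allSubsets n))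

d : ∀ {n} → Graph n → ℕ → ℕ
d {n} G j = length (filterB (λ D → isDominating G D ∧ (∣ D ∣ ≡ᵇ j)) (allSubsets n))

dₐ : ∀ {n} → Graph n → ℕ → ℕ
dₐ {n} G j = length (filterB (λ D → isAccurate G D ∧ (∣ D ∣ ≡ᵇ j)) (allSubsets n))

-- Σ_{k=a}^{b} f k  (empty, i.e. 0, when b < a).
sumFromTo : ℕ → ℕ → (ℕ → ℕ) → ℕ
sumFromTo a b f = sum (map (λ t → f (a + t)) (upTo (suc b ∸ a)))

module Submission where

-- If an accurate dominating set D of the cycle with 2|D| ≤ n had no three consecutive vertices, then
-- the non-members whose predecessor lies in D, or whose two successors both lie in D, would form a
-- dominating set disjoint from D with at most |D| elements; padded to |D| elements it would contradict
-- accuracy.  So D contains a maximal run r, …, r + k - 1 of k ≥ 3 members, flanked by non-members,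
-- and the remaining n - k - 2 vertices meet D in a dominating set of the path P_{n-k-2} with i - k
-- elements, which is nonempty, so k ≤ i - 1.  Since D is determined by r, k and that set, d_a(C_n, i)
-- is at most the number of such triples.

open import Defs
open import Data.Nat using (ℕ; zero; suc; _+_; _*_; _∸_; _/_; _%_; _≤_; _<_; _≡ᵇ_; z≤n; s≤s; s≤s⁻¹)
open import Data.Nat.Properties
open import Data.Nat.DivMod using (m%n<n; %-distribˡ-+; m%n%n≡m%n; m<n⇒m%n≡m; [m+kn]%n≡m%n; m/n*n≤m; /-mono-≤)
open import Data.Nat.ListAction using (sum)
open import Data.Nat.ListAction.Properties using (sum-++)
open import Data.Bool using (Bool; true; false; _∧_; _∨_; not; T)
import Data.Bool as Bool
open import Data.Bool.Properties using (T-∨; T-∧; T-≡; T-not-≡; T?; ∧-distribˡ-∨)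
open import Data.Bool.ListAction using (all; any)
open import Data.Fin using (Fin; toℕ; fromℕ<) renaming (zero to fzero; suc to fsuc)
import Data.Fin.Properties as Fin
open import Data.Fin.Subset using (Subset; ∣_∣)
open import Data.Vec using (Vec; []; _∷_; lookup; tabulate)
open import Data.Vec.Properties using (≡-dec; lookup∘tabulate; tabulate∘lookup; tabulate-cong)
open import Data.List using (List; []; _∷_; map; _++_; length; upTo; allFin)
open import Data.List using () renaming (filterᵇ to filterB)
open import Data.List.Properties using (map-++; map-∘; map-tabulate)
open import Data.List.Membership.Propositional using (_∈_; lose)
open import Data.List.Membership.Propositional.Properties using (∈-allFin; ∈-++⁺ˡ; ∈-++⁺ʳ; ∈-map⁺; ∈-upTo⁺)
open import Data.List.Relation.Unary.Any using (here; there)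
import Data.List.Relation.Unary.All as All
open import Data.List.Relation.Unary.All.Properties using (all⁺; all⁻)
open import Data.List.Relation.Unary.Any.Properties using (any⁺; any⁻)
import Data.List.Relation.Unary.Any as Any
open import Data.Product using (Σ; ∃; _×_; _,_; proj₁; proj₂)
open import Data.Sum using (_⊎_; inj₁; inj₂)
import Data.Sum as Sum
open import Data.Empty using (⊥; ⊥-elim)
open import Function using (_∘_; id; Equivalence)
open import Relation.Nullary using (¬_; ¬?; does; yes; no)
open import Relation.Nullary.Decidable using (dec-true; decidable-stable; _×-dec_)
open import Relation.Binary.PropositionalEquality
open import Relation.Binary.Definitions using (DecidableEquality)
open import Data.Nat.Tactic.RingSolver using (solve-∀)

⟦_⟧ : Bool → ℕ
⟦ true ⟧ = 1
⟦ false ⟧ = 0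

∨-introˡ : ∀ {a b} → T a → T (a ∨ b)
∨-introˡ = Equivalence.from T-∨ ∘ inj₁

∨-introʳ : ∀ {a b} → T b → T (a ∨ b)
∨-introʳ = Equivalence.from T-∨ ∘ inj₂

∨-elim : ∀ {a b} → T (a ∨ b) → T a ⊎ T b
∨-elim = Equivalence.to T-∨

∧-elim : ∀ {a b} → T (a ∧ b) → T a × T b
∧-elim = Equivalence.to T-∧

∧-intro : ∀ {a b} → T a → T b → T (a ∧ b)
∧-intro p q = Equivalence.from T-∧ (p , q)

not-intro : ∀ {a} → ¬ T a → T (not a)
not-intro {false} _  = _
not-intro {true}  ¬a = ¬a _

not-elim : ∀ {a} → T (not a) → ¬ T a
not-elim {false} _ ()

⟦∨⟧≤ : ∀ a b → ⟦ a ∨ b ⟧ ≤ ⟦ a ⟧ + ⟦ b ⟧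
⟦∨⟧≤ true  b = s≤s z≤n
⟦∨⟧≤ false b = ≤-refl

T⇒⟦⟧≡1 : ∀ {b} → T b → ⟦ b ⟧ ≡ 1
T⇒⟦⟧≡1 {true} _ = refl

⟦⟧≤ : ∀ b {x} → (T b → 1 ≤ x) → ⟦ b ⟧ ≤ x
⟦⟧≤ true  1≤x = 1≤x _
⟦⟧≤ false _   = z≤n

¬T⇒⟦⟧≡0 : ∀ {b} → ¬ T b → ⟦ b ⟧ ≡ 0
¬T⇒⟦⟧≡0 {false} _ = refl
¬T⇒⟦⟧≡0 {true}  ¬b = ⊥-elim (¬b _)

T⇒≡true : ∀ {b} → T b → b ≡ true
T⇒≡true = Equivalence.to T-≡

¬T⇒≡false : ∀ {b} → ¬ T b → b ≡ false
¬T⇒≡false = Equivalence.to T-not-≡ ∘ not-intro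

module _ {A : Set} where

  sumList : List A → (A → ℕ) → ℕ
  sumList xs f = sum (map f xs)

  syntax sumList xs (λ x → e) = ∑[ x ∈ xs ] e

  sumList-cong : ∀ xs {f g : A → ℕ} → (∀ x → f x ≡ g x) → sumList xs f ≡ sumList xs g
  sumList-cong []       eq = refl
  sumList-cong (x ∷ xs) eq = cong₂ _+_ (eq x) (sumList-cong xs eq)

  sumList-mono : ∀ xs {f g : A → ℕ} → (∀ x → f x ≤ g x) → sumList xs f ≤ sumList xs g
  sumList-mono []       le = z≤n
  sumList-mono (x ∷ xs) le = +-mono-≤ (le x) (sumList-mono xs le)

  sumList-zero : ∀ xs → ∑[ x ∈ xs ] 0 ≡ 0
  sumList-zero []       = refl
  sumList-zero (x ∷ xs) = sumList-zero xs

  sumList-+ : ∀ xs (f g : A → ℕ) → ∑[ x ∈ xs ] (f x + g x) ≡ sumList xs f + sumList xs g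
  sumList-+ []       f g = refl
  sumList-+ (x ∷ xs) f g = begin
    f x + g x + sumList xs (λ y → f y + g y)  ≡⟨ cong (f x + g x +_) (sumList-+ xs f g) ⟩
    f x + g x + (sumList xs f + sumList xs g) ≡⟨ +-+-comm (f x) (g x) _ _ ⟩
    (f x + sumList xs f) + (g x + sumList xs g) ∎
    where
    open ≡-Reasoning
    +-+-comm : ∀ a b c d → a + b + (c + d) ≡ (a + c) + (b + d)
    +-+-comm = solve-∀

  sumList-∈ : ∀ {xs x} (f : A → ℕ) → x ∈ xs → f x ≤ sumList xs f
  sumList-∈ f (here refl) = m≤m+n _ _
  sumList-∈ {y ∷ _} f (there x∈xs) = ≤-trans (sumList-∈ f x∈xs) (m≤n+m _ (f y))

  sumList-++ : ∀ xs ys (f : A → ℕ) → sumList (xs ++ ys) f ≡ sumList xs f + sumList ys f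
  sumList-++ xs ys f = trans (cong sum (map-++ f xs ys)) (sum-++ (map f xs) (map f ys))

  length-filterᵇ : ∀ (p : A → Bool) xs → length (filterB p xs) ≡ ∑[ x ∈ xs ] ⟦ p x ⟧
  length-filterᵇ p []       = refl
  length-filterᵇ p (x ∷ xs) with p x
  ... | true  = cong suc (length-filterᵇ p xs)
  ... | false = length-filterᵇ p xs

sumList-map : ∀ {A B : Set} (g : A → B) xs (f : B → ℕ) → sumList (map g xs) f ≡ sumList xs (f ∘ g)
sumList-map g xs f = cong sum (sym (map-∘ xs))

sumList-swap : ∀ {A B : Set} xs ys (f : A → B → ℕ) →
  ∑[ x ∈ xs ] ∑[ y ∈ ys ] f x y ≡ ∑[ y ∈ ys ] ∑[ x ∈ xs ] f x y
sumList-swap []       ys f = sym (sumList-zero ys)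
sumList-swap (x ∷ xs) ys f = begin
  sumList ys (f x) + (∑[ x' ∈ xs ] ∑[ y ∈ ys ] f x' y) ≡⟨ cong (sumList ys (f x) +_) (sumList-swap xs ys f) ⟩
  sumList ys (f x) + (∑[ y ∈ ys ] ∑[ x' ∈ xs ] f x' y) ≡⟨ sumList-+ ys (f x) _ ⟨
  ∑[ y ∈ ys ] (f x y + ∑[ x' ∈ xs ] f x' y)             ∎
  where open ≡-Reasoning

sumBelow : ℕ → (ℕ → ℕ) → ℕ
sumBelow zero    h = 0
sumBelow (suc L) h = h 0 + sumBelow L (h ∘ suc)

syntax sumBelow L (λ a → e) = ∑[ a < L ] e

sumBelow-cong : ∀ L {h h' : ℕ → ℕ} → (∀ a → a < L → h a ≡ h' a) → sumBelow L h ≡ sumBelow L h'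
sumBelow-cong zero    eq = refl
sumBelow-cong (suc L) eq = cong₂ _+_ (eq 0 (s≤s z≤n)) (sumBelow-cong L (λ a a<L → eq (suc a) (s≤s a<L)))

sumBelow-+ : ∀ L L' h → sumBelow (L + L') h ≡ sumBelow L h + ∑[ a < L' ] h (L + a)
sumBelow-+ zero    L' h = refl
sumBelow-+ (suc L) L' h = trans (cong (h 0 +_) (sumBelow-+ L L' (h ∘ suc))) (sym (+-assoc (h 0) _ _))

sumBelow-const : ∀ L c → ∑[ a < L ] c ≡ L * c
sumBelow-const zero    c = refl
sumBelow-const (suc L) c = cong (c +_) (sumBelow-const L c)

sumBelow-suc : ∀ L h → ∑[ a < L ] h (suc a) + h 0 ≡ sumBelow L h + h L
sumBelow-suc zero    h = refl
sumBelow-suc (suc L) h = begin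
  h 1 + sumBelow L (h ∘ suc ∘ suc) + h 0   ≡⟨ +-comm (h 1 + _) (h 0) ⟩
  h 0 + (h 1 + sumBelow L (h ∘ suc ∘ suc)) ≡⟨ cong (h 0 +_) (+-comm (h 1) _) ⟩
  h 0 + (sumBelow L (h ∘ suc ∘ suc) + h 1) ≡⟨ cong (h 0 +_) (sumBelow-suc L (h ∘ suc)) ⟩
  h 0 + (sumBelow L (h ∘ suc) + h (suc L)) ≡⟨ +-assoc (h 0) _ _ ⟨
  h 0 + sumBelow L (h ∘ suc) + h (suc L)   ∎
  where open ≡-Reasoning

sumBelow-periodic : ∀ L h → (∀ x → h (x + L) ≡ h x) → ∀ t → ∑[ a < L ] h (t + a) ≡ sumBelow L h
sumBelow-periodic L h per zero    = refl
sumBelow-periodic L h per (suc t) = begin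
  ∑[ a < L ] h (suc t + a)  ≡⟨ sumBelow-cong L (λ a _ → cong h (sym (+-suc t a))) ⟩
  ∑[ a < L ] h (t + suc a)  ≡⟨ +-cancelʳ-≡ _ _ _ (trans (sumBelow-suc L (λ a → h (t + a)))
                                 (cong (sumBelow L (λ a → h (t + a)) +_) (trans (per t) (cong h (sym (+-identityʳ t)))))) ⟩
  ∑[ a < L ] h (t + a)      ≡⟨ sumBelow-periodic L h per t ⟩
  sumBelow L h              ∎
  where open ≡-Reasoning

sumFin-suc : ∀ {L} (f : Fin (suc L) → ℕ) → sumList (allFin (suc L)) f ≡ f fzero + sumList (allFin L) (f ∘ fsuc)
sumFin-suc {L} f = cong (λ xs → f fzero + sum xs)
  (trans (map-tabulate fsuc f) (sym (map-tabulate id (f ∘ fsuc))))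

sumFin-sumBelow : ∀ {L} (f : Fin L → ℕ) (h : ℕ → ℕ) → (∀ i → f i ≡ h (toℕ i)) →
  sumList (allFin L) f ≡ sumBelow L h
sumFin-sumBelow {zero}  f h eq = refl
sumFin-sumBelow {suc L} f h eq =
  trans (sumFin-suc f) (cong₂ _+_ (eq fzero) (sumFin-sumBelow (f ∘ fsuc) (h ∘ suc) (eq ∘ fsuc)))

card≡sum : ∀ {L} (S : Subset L) → ∣ S ∣ ≡ ∑[ v ∈ allFin L ] ⟦ lookup S v ⟧
card≡sum []          = refl
card≡sum (true ∷ S)  = trans (cong suc (card≡sum S)) (sym (sumFin-suc (λ v → ⟦ lookup (true ∷ S) v ⟧)))
card≡sum (false ∷ S) = trans (card≡sum S) (sym (sumFin-suc (λ v → ⟦ lookup (false ∷ S) v ⟧)))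

member⇒1≤card : ∀ {L} (S : Subset L) v → T (lookup S v) → 1 ≤ ∣ S ∣
member⇒1≤card S v v∈S = begin
  1                                   ≡⟨ T⇒⟦⟧≡1 v∈S ⟨
  ⟦ lookup S v ⟧                      ≤⟨ sumList-∈ (λ v → ⟦ lookup S v ⟧) (∈-allFin v) ⟩
  ∑[ u ∈ allFin _ ] ⟦ lookup S u ⟧    ≡⟨ card≡sum S ⟨
  ∣ S ∣                               ∎
  where open ≤-Reasoning

_≟ˢ_ : ∀ {L} → DecidableEquality (Subset L)
_≟ˢ_ = ≡-dec Bool._≟_

∈-allSubsets : ∀ {L} (S : Subset L) → S ∈ allSubsets L
∈-allSubsets []          = here refl
∈-allSubsets {suc L} (true ∷ S)  = ∈-++⁺ˡ (∈-map⁺ (true ∷_) (∈-allSubsets S))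
∈-allSubsets {suc L} (false ∷ S) = ∈-++⁺ʳ (map (true ∷_) (allSubsets L)) (∈-map⁺ (false ∷_) (∈-allSubsets S))

sum-allSubsets-suc : ∀ L (f : Subset (suc L) → ℕ) →
  sumList (allSubsets (suc L)) f ≡ ∑[ S ∈ allSubsets L ] f (true ∷ S) + ∑[ S ∈ allSubsets L ] f (false ∷ S)
sum-allSubsets-suc L f = trans (sumList-++ (map (true ∷_) (allSubsets L)) _ f)
  (cong₂ _+_ (sumList-map _ (allSubsets L) f) (sumList-map _ (allSubsets L) f))

count-≡-allSubsets : ∀ {L} (S : Subset L) → ∑[ S' ∈ allSubsets L ] ⟦ does (S' ≟ˢ S) ⟧ ≡ 1
count-≡-allSubsets [] = refl
count-≡-allSubsets {suc L} (b ∷ S) = trans (sum-allSubsets-suc L (λ S' → ⟦ does (S' ≟ˢ (b ∷ S)) ⟧)) (split b)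
  where
  split : ∀ b → ∑[ S' ∈ allSubsets L ] ⟦ does ((true ∷ S') ≟ˢ (b ∷ S)) ⟧
              + ∑[ S' ∈ allSubsets L ] ⟦ does ((false ∷ S') ≟ˢ (b ∷ S)) ⟧ ≡ 1
  split true  rewrite count-≡-allSubsets S | sumList-zero (allSubsets L) = refl
  split false rewrite count-≡-allSubsets S | sumList-zero (allSubsets L) = refl

module _ {L : ℕ} where

  infix 4 _⊆_
  _⊆_ : Subset L → Subset L → Set
  S ⊆ S' = ∀ v → T (lookup S v) → T (lookup S' v)

  Disjoint : Subset L → Subset L → Set
  Disjoint S X = ∀ v → T (lookup S v) → T (lookup X v) → ⊥

⊆-∷ : ∀ {L} {b b'} {S S' : Subset L} → (T b → T b') → S ⊆ S' → (b ∷ S) ⊆ (b' ∷ S')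
⊆-∷ b⇒b' S⊆S' fzero    = b⇒b'
⊆-∷ b⇒b' S⊆S' (fsuc v) = S⊆S' v

Disjoint-∷ : ∀ {L} {b c} {S X : Subset L} → (T b → T c → ⊥) → Disjoint S X → Disjoint (b ∷ S) (c ∷ X)
Disjoint-∷ bc S∩X fzero    = bc
Disjoint-∷ bc S∩X (fsuc v) = S∩X v

pad : ∀ {L} (S X : Subset L) t → Disjoint S X → t + ∣ S ∣ + ∣ X ∣ ≤ L →
  Σ (Subset L) λ S' → S ⊆ S' × Disjoint S' X × ∣ S' ∣ ≡ t + ∣ S ∣
pad S X zero S∩X _ = S , (λ _ p → p) , S∩X , refl
pad [] [] (suc t) _ ()
pad (true ∷ S) (true ∷ X) (suc t) S∩X _ = ⊥-elim (S∩X fzero _ _)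
pad (true ∷ S) (false ∷ X) (suc t) S∩X le
  with S' , S⊆S' , S'∩X , card ← pad S X (suc t) (S∩X ∘ fsuc)
         (s≤s⁻¹ (≤-trans (≤-reflexive (cong (_+ ∣ X ∣) (sym (+-suc (suc t) ∣ S ∣)))) le))
  = true ∷ S' , ⊆-∷ _ S⊆S' , Disjoint-∷ (λ _ ()) S'∩X , trans (cong suc card) (sym (+-suc (suc t) ∣ S ∣))
pad (false ∷ S) (true ∷ X) (suc t) S∩X le
  with S' , S⊆S' , S'∩X , card ← pad S X (suc t) (S∩X ∘ fsuc)
         (s≤s⁻¹ (≤-trans (≤-reflexive (sym (+-suc (suc t + ∣ S ∣) ∣ X ∣))) le))
  = false ∷ S' , ⊆-∷ (λ ()) S⊆S' , Disjoint-∷ (λ ()) S'∩X , card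
pad (false ∷ S) (false ∷ X) (suc t) S∩X le
  with S' , S⊆S' , S'∩X , card ← pad S X t (S∩X ∘ fsuc) (s≤s⁻¹ le)
  = true ∷ S' , ⊆-∷ (λ ()) S⊆S' , Disjoint-∷ (λ _ ()) S'∩X , cong suc card

disjointFrom-intro : ∀ {L} (S X : Subset L) → Disjoint S X → T (disjointFrom S X)
disjointFrom-intro {L} S X S∩X =
  all⁻ (λ v → not (lookup S v ∧ lookup X v)) {allFin L}
    (All.tabulate (λ {v} _ → not-intro (λ p → let Sv , Xv = ∧-elim {lookup S v} p in S∩X v Sv Xv)))

accurate⇒noRival : ∀ {L} (G : Graph L) (D : Subset L) → T (isAccurate G D) →
  ∀ S → T (disjointFrom S D) → ∣ S ∣ ≡ ∣ D ∣ → ¬ T (isDominating G S)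
accurate⇒noRival {L} G D accurate S S∩D card dom =
  not-elim (proj₂ (∧-elim {isDominating G D} accurate)) (any⁺ rival (lose (∈-allSubsets S)
    (∧-intro {disjointFrom S D} S∩D (∧-intro {∣ S ∣ ≡ᵇ ∣ D ∣} (≡⇒≡ᵇ _ _ card) dom))))
  where
  rival : Subset L → Bool
  rival S = disjointFrom S D ∧ (∣ S ∣ ≡ᵇ ∣ D ∣) ∧ isDominating G S

dominating⇒nonempty : ∀ {m} (G : Graph m) (P : Subset m) → 0 < m → T (isDominating G P) → 1 ≤ ∣ P ∣
dominating⇒nonempty {suc m} G P _ dom
  with ∨-elim {lookup P fzero} (All.lookup (all⁺ (λ v → lookup P v ∨ any (λ u → lookup P u ∧ G u v) (allFin (suc m)))
                                                  (allFin (suc m)) dom) (∈-allFin fzero))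
... | inj₁ 0∈P = member⇒1≤card P fzero 0∈P
... | inj₂ p with u , q ← Any.satisfied (any⁻ (λ u → lookup P u ∧ G u fzero) (allFin (suc m)) p)
  = member⇒1≤card P u (proj₁ (∧-elim {lookup P u} q))

lastFalseUpTo : ∀ (f : ℕ → Bool) → ¬ T (f 0) → ∀ o →
  ∃ λ j → j ≤ o × ¬ T (f j) × (∀ x → j < x → x ≤ o → T (f x))
lastFalseUpTo f ¬f₀ zero = zero , z≤n , ¬f₀ , λ x 0<x x≤0 → ⊥-elim (<⇒≱ 0<x x≤0)
lastFalseUpTo f ¬f₀ (suc o) with T? (f (suc o))
... | no ¬fo = suc o , ≤-refl , ¬fo , λ x o<x x≤o → ⊥-elim (<⇒≱ o<x x≤o)
... | yes fo with j , j≤o , ¬fj , run ← lastFalseUpTo f ¬f₀ o =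
  j , m≤n⇒m≤1+n j≤o , ¬fj , extend
  where
  extend : ∀ x → j < x → x ≤ suc o → T (f x)
  extend x j<x x≤o+1 with m≤n⇒m<n∨m≡n x≤o+1
  ... | inj₁ x<o+1 = run x j<x (s≤s⁻¹ x<o+1)
  ... | inj₂ refl  = fo

firstFalseFrom : ∀ (f : ℕ → Bool) s d → ¬ T (f (s + d)) →
  ∃ λ e → s ≤ e × e ≤ s + d × ¬ T (f e) × (∀ x → s ≤ x → x < e → T (f x))
firstFalseFrom f s d ¬fs+d with T? (f s)
... | no ¬fs = s , ≤-refl , m≤m+n s d , ¬fs , λ x s≤x x<s → ⊥-elim (<⇒≱ x<s s≤x)
firstFalseFrom f s zero ¬fs+0 | yes fs = ⊥-elim (¬fs+0 (subst (T ∘ f) (sym (+-identityʳ s)) fs))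
firstFalseFrom f s (suc d) ¬fs+d | yes fs
  with e , s<e , e≤ , ¬fe , run ← firstFalseFrom f (suc s) d (subst (¬_ ∘ T ∘ f) (+-suc s d) ¬fs+d) =
  e , <⇒≤ s<e , ≤-trans e≤ (≤-reflexive (sym (+-suc s d))) , ¬fe , extend
  where
  extend : ∀ x → s ≤ x → x < e → T (f x)
  extend x s≤x x<e with m≤n⇒m<n∨m≡n s≤x
  ... | inj₁ s<x = run x s<x x<e
  ... | inj₂ refl = fs

maximalRun : ∀ (f : ℕ → Bool) {L o l} → ¬ T (f 0) → ¬ T (f L) → o ≤ L →
  (∀ x → o ≤ x → x ≤ o + l → T (f x)) →
  ∃ λ j → ∃ λ k → l < k × suc j + k ≤ L × ¬ T (f j) × ¬ T (f (suc j + k)) × (∀ a → a < k → T (f (suc j + a)))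
maximalRun f {L} {o} {l} ¬f₀ ¬fL o≤L block
  with j , j≤o , ¬fj , left ← lastFalseUpTo f ¬f₀ o
  with e , o≤e , e≤ , ¬fe , right ← firstFalseFrom f o (L ∸ o) (subst (¬_ ∘ T ∘ f) (sym (m+[n∸m]≡n o≤L)) ¬fL)
  = j , e ∸ suc j , l<k
  , ≤-trans (≤-reflexive j+1+k≡e) (≤-trans e≤ (≤-reflexive (m+[n∸m]≡n o≤L)))
  , ¬fj , subst (¬_ ∘ T ∘ f) (sym j+1+k≡e) ¬fe
  , λ a a<k → run (suc j + a) (s≤s (m≤m+n j a)) (≤-trans (+-monoʳ-< (suc j) a<k) (≤-reflexive j+1+k≡e))
  where
  j<o : j < o
  j<o with m≤n⇒m<n∨m≡n j≤o
  ... | inj₁ j<o = j<o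
  ... | inj₂ j≡o = ⊥-elim (¬fj (block j (≤-reflexive (sym j≡o)) (≤-trans (≤-reflexive j≡o) (m≤m+n o l))))
  o+l<e : o + l < e
  o+l<e with o + l <? e
  ... | yes o+l<e = o+l<e
  ... | no o+l≮e = ⊥-elim (¬fe (block e o≤e (≮⇒≥ o+l≮e)))
  j+1+k≡e : suc j + (e ∸ suc j) ≡ e
  j+1+k≡e = m+[n∸m]≡n (<-trans j<o (≤-trans (m≤m+n (suc o) l) o+l<e))
  l<k : l < e ∸ suc j
  l<k = ≤-trans (≤-reflexive (sym (m+n∸m≡n o (suc l)))) (∸-mono (≤-trans (≤-reflexive (+-suc o l)) o+l<e) j<o)
  run : ∀ x → j < x → x < e → T (f x)
  run x j<x x<e with x ≤? o
  ... | yes x≤o = left x j<x x≤o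
  ... | no x≰o = right x (<⇒≤ (≰⇒> x≰o)) x<e

lookup₀ : ∀ {m} → Vec Bool m → ℕ → Bool
lookup₀ []      _       = false
lookup₀ (b ∷ _) zero    = b
lookup₀ (_ ∷ P) (suc t) = lookup₀ P t

lookup₀-tabulate : ∀ {m} (g : Fin m → Bool) t (t<m : t < m) → lookup₀ (tabulate g) t ≡ g (fromℕ< t<m)
lookup₀-tabulate {suc m} g zero    _         = refl
lookup₀-tabulate {suc m} g (suc t) (s≤s t<m) = lookup₀-tabulate (g ∘ fsuc) t t<m

lookup₀-beyond : ∀ {m} (P : Vec Bool m) t → m ≤ t → lookup₀ P t ≡ false
lookup₀-beyond []      t       _         = refl
lookup₀-beyond (_ ∷ P) (suc t) (s≤s m≤t) = lookup₀-beyond P t m≤t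

-- Membership of the vertex a steps after the start r of the set coded by (r, k, P): k members,
-- one non-member, then P, then non-members.
layout : ∀ {m} → ℕ → Vec Bool m → ℕ → Bool
layout zero    P a       = lookup₀ (false ∷ P) a
layout (suc k) P zero    = true
layout (suc k) P (suc a) = layout k P a

layout-run : ∀ {m} k (P : Vec Bool m) a → a < k → layout k P a ≡ true
layout-run (suc k) P zero    _         = refl
layout-run (suc k) P (suc a) (s≤s a<k) = layout-run k P a a<k

layout-after : ∀ {m} k (P : Vec Bool m) b → layout k P (k + b) ≡ lookup₀ (false ∷ P) b
layout-after zero    P b = refl
layout-after (suc k) P b = layout-after k P b

isDominating-path⁺ : ∀ m (w : ℕ → Bool) → ¬ T (w 0) → ¬ T (w (suc m)) →
  (∀ t → t < m → T (w (suc t)) ⊎ T (w t) ⊎ T (w (suc (suc t)))) →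
  T (isDominating (pathG m) (tabulate (λ u → w (suc (toℕ u)))))
isDominating-path⁺ m w ¬w₀ ¬wₘ₊₁ dom =
  all⁻ DominatedAt {allFin m} (All.tabulate (λ {t} _ → dominated t (dom (toℕ t) (Fin.toℕ<n t))))
  where
  P : Subset m
  P = tabulate (λ u → w (suc (toℕ u)))
  DominatedAt : Fin m → Bool
  DominatedAt t = lookup P t ∨ any (λ u → lookup P u ∧ pathG m u t) (allFin m)
  inP : ∀ {u} → T (w (suc (toℕ u))) → T (lookup P u)
  inP {u} = subst T (sym (lookup∘tabulate _ u))
  neighbour : ∀ {t} u → T (w (suc (toℕ u))) → T (pathG m u t) → T (DominatedAt t)
  neighbour {t} u wu adj = ∨-introʳ {lookup P t}
    (any⁺ (λ u → lookup P u ∧ pathG m u t) (lose (∈-allFin u) (∧-intro {lookup P u} (inP wu) adj)))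
  dominated : ∀ t → T (w (suc (toℕ t))) ⊎ T (w (toℕ t)) ⊎ T (w (suc (suc (toℕ t)))) → T (DominatedAt t)
  dominated t (inj₁ p) = ∨-introˡ (inP p)
  dominated t (inj₂ (inj₁ p)) = viaPredecessor (toℕ t) refl p
    where
    viaPredecessor : ∀ x → x ≡ toℕ t → T (w x) → T (DominatedAt t)
    viaPredecessor zero    _  p = ⊥-elim (¬w₀ p)
    viaPredecessor (suc x) eq p = neighbour u (subst (T ∘ w ∘ suc) (sym toℕu) p)
                                    (∨-introˡ (≡⇒≡ᵇ _ _ (trans (sym eq) (cong suc (sym toℕu)))))
      where
      x<m : x < m
      x<m = <-trans (n<1+n x) (subst (_< m) (sym eq) (Fin.toℕ<n t))
      u : Fin m
      u = fromℕ< x<m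
      toℕu : toℕ u ≡ x
      toℕu = Fin.toℕ-fromℕ< x<m
  dominated t (inj₂ (inj₂ p)) with suc (toℕ t) <? m
  ... | yes t+1<m = neighbour (fromℕ< t+1<m) (subst (T ∘ w ∘ suc) (sym (Fin.toℕ-fromℕ< t+1<m)) p)
                      (∨-introʳ {toℕ t ≡ᵇ suc (toℕ (fromℕ< t+1<m))} (≡⇒≡ᵇ _ _ (Fin.toℕ-fromℕ< t+1<m)))
  ... | no t+1≮m = ⊥-elim (¬wₘ₊₁ (subst (T ∘ w ∘ suc) (≤-antisym (Fin.toℕ<n t) (≮⇒≥ t+1≮m)) p))

-- The cycle on suc n vertices, in which v ⊕ n is the predecessor of v

module _ {n : ℕ} where

  infixl 6 _⊕_
  _⊕_ : Fin (suc n) → ℕ → Fin (suc n)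
  r ⊕ a = fromℕ< (m%n<n (toℕ r + a) (suc n))

  toℕ-⊕ : ∀ r a → toℕ (r ⊕ a) ≡ (toℕ r + a) % suc n
  toℕ-⊕ r a = Fin.toℕ-fromℕ< _

  %-+ˡ : ∀ x y → (x % suc n + y) % suc n ≡ (x + y) % suc n
  %-+ˡ x y = begin
    (x % suc n + y) % suc n              ≡⟨ %-distribˡ-+ (x % suc n) y (suc n) ⟩
    (x % suc n % suc n + y % suc n) % suc n ≡⟨ cong (λ z → (z + y % suc n) % suc n) (m%n%n≡m%n x (suc n)) ⟩
    (x % suc n + y % suc n) % suc n      ≡⟨ %-distribˡ-+ x y (suc n) ⟨
    (x + y) % suc n                      ∎
    where open ≡-Reasoning

  ⊕-assoc : ∀ r a b → r ⊕ a ⊕ b ≡ r ⊕ (a + b)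
  ⊕-assoc r a b = Fin.toℕ-injective (begin
    toℕ (r ⊕ a ⊕ b)               ≡⟨ toℕ-⊕ (r ⊕ a) b ⟩
    (toℕ (r ⊕ a) + b) % suc n     ≡⟨ cong (λ z → (z + b) % suc n) (toℕ-⊕ r a) ⟩
    ((toℕ r + a) % suc n + b) % suc n ≡⟨ %-+ˡ (toℕ r + a) b ⟩
    (toℕ r + a + b) % suc n       ≡⟨ cong (_% suc n) (+-assoc (toℕ r) a b) ⟩
    (toℕ r + (a + b)) % suc n     ≡⟨ toℕ-⊕ r (a + b) ⟨
    toℕ (r ⊕ (a + b))             ∎)
    where open ≡-Reasoning

  ⊕-identityʳ : ∀ r → r ⊕ 0 ≡ r
  ⊕-identityʳ r = Fin.toℕ-injective (begin
    toℕ (r ⊕ 0)           ≡⟨ toℕ-⊕ r 0 ⟩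
    (toℕ r + 0) % suc n   ≡⟨ cong (_% suc n) (+-identityʳ (toℕ r)) ⟩
    toℕ r % suc n         ≡⟨ m<n⇒m%n≡m (Fin.toℕ<n r) ⟩
    toℕ r                 ∎)
    where open ≡-Reasoning

  ⊕-wrap : ∀ r {a b} → a ≡ b + suc n → r ⊕ a ≡ r ⊕ b
  ⊕-wrap r {a} {b} refl = Fin.toℕ-injective (begin
    toℕ (r ⊕ (b + suc n))         ≡⟨ toℕ-⊕ r (b + suc n) ⟩
    (toℕ r + (b + suc n)) % suc n
      ≡⟨ cong (_% suc n) (trans (sym (+-assoc (toℕ r) b (suc n))) (cong (toℕ r + b +_) (sym (+-identityʳ (suc n))))) ⟩
    (toℕ r + b + 1 * suc n) % suc n ≡⟨ [m+kn]%n≡m%n (toℕ r + b) 1 (suc n) ⟩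
    (toℕ r + b) % suc n           ≡⟨ toℕ-⊕ r b ⟨
    toℕ (r ⊕ b)                   ∎)
    where open ≡-Reasoning

  offset : Fin (suc n) → Fin (suc n) → ℕ
  offset r v = (toℕ v + (suc n ∸ toℕ r)) % suc n

  offset< : ∀ r v → offset r v < suc n
  offset< r v = m%n<n (toℕ v + (suc n ∸ toℕ r)) (suc n)

  ⊕-offset : ∀ r v → r ⊕ offset r v ≡ v
  ⊕-offset r v = Fin.toℕ-injective (begin
    toℕ (r ⊕ offset r v)                         ≡⟨ toℕ-⊕ r (offset r v) ⟩
    (toℕ r + (toℕ v + (suc n ∸ toℕ r)) % suc n) % suc n ≡⟨ cong (_% suc n) (+-comm (toℕ r) _) ⟩
    ((toℕ v + (suc n ∸ toℕ r)) % suc n + toℕ r) % suc n ≡⟨ %-+ˡ (toℕ v + (suc n ∸ toℕ r)) (toℕ r) ⟩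
    (toℕ v + (suc n ∸ toℕ r) + toℕ r) % suc n
      ≡⟨ cong (_% suc n) (trans (+-assoc (toℕ v) _ _)
           (cong (toℕ v +_) (trans (m∸n+n≡m (<⇒≤ (Fin.toℕ<n r))) (sym (+-identityʳ (suc n)))))) ⟩
    (toℕ v + 1 * suc n) % suc n                  ≡⟨ [m+kn]%n≡m%n (toℕ v) 1 (suc n) ⟩
    toℕ v % suc n                                ≡⟨ m<n⇒m%n≡m (Fin.toℕ<n v) ⟩
    toℕ v                                        ∎)
    where open ≡-Reasoning

  sum-rotate : ∀ (f : Fin (suc n) → ℕ) r → sumList (allFin (suc n)) f ≡ ∑[ a < suc n ] f (r ⊕ a)
  sum-rotate f r = begin
    sumList (allFin (suc n)) f         ≡⟨ sumFin-sumBelow f (λ a → f (fzero ⊕ a)) (λ v → cong f (sym (fzero⊕toℕ v))) ⟩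
    ∑[ a < suc n ] f (fzero ⊕ a)
      ≡⟨ sumBelow-periodic (suc n) (λ a → f (fzero ⊕ a)) (λ x → cong f (⊕-wrap fzero {x + suc n} {x} refl)) (toℕ r) ⟨
    ∑[ a < suc n ] f (fzero ⊕ (toℕ r + a)) ≡⟨ sumBelow-cong (suc n) (λ a _ → cong f (⊕-rebase a)) ⟩
    ∑[ a < suc n ] f (r ⊕ a)            ∎
    where
    open ≡-Reasoning
    fzero⊕toℕ : ∀ v → fzero ⊕ toℕ v ≡ v
    fzero⊕toℕ v = Fin.toℕ-injective (trans (toℕ-⊕ fzero (toℕ v)) (m<n⇒m%n≡m (Fin.toℕ<n v)))
    ⊕-rebase : ∀ a → fzero ⊕ (toℕ r + a) ≡ r ⊕ a
    ⊕-rebase a = Fin.toℕ-injective (trans (toℕ-⊕ fzero (toℕ r + a)) (sym (toℕ-⊕ r a)))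

  sum-⊕-invariant : ∀ (h : Fin (suc n) → ℕ) a → ∑[ v ∈ allFin (suc n) ] h (v ⊕ a) ≡ sumList (allFin (suc n)) h
  sum-⊕-invariant h a = begin
    ∑[ v ∈ allFin (suc n) ] h (v ⊕ a)   ≡⟨ sum-rotate _ fzero ⟩
    ∑[ x < suc n ] h (fzero ⊕ x ⊕ a)    ≡⟨ sumBelow-cong (suc n) (λ x _ → cong h (swap x)) ⟩
    ∑[ x < suc n ] h (fzero ⊕ a ⊕ x)    ≡⟨ sum-rotate h (fzero ⊕ a) ⟨
    sumList (allFin (suc n)) h          ∎
    where
    open ≡-Reasoning
    swap : ∀ x → fzero ⊕ x ⊕ a ≡ fzero ⊕ a ⊕ x
    swap x = trans (⊕-assoc fzero x a) (trans (cong (fzero ⊕_) (+-comm x a)) (sym (⊕-assoc fzero a x)))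

  card-rotate : ∀ (S : Subset (suc n)) r → ∣ S ∣ ≡ ∑[ a < suc n ] ⟦ lookup S (r ⊕ a) ⟧
  card-rotate S r = trans (card≡sum S) (sum-rotate _ r)

  ⊕-⊕-wrap : ∀ v {a b c} → a + b ≡ c + suc n → v ⊕ a ⊕ b ≡ v ⊕ c
  ⊕-⊕-wrap v {a} {b} eq = trans (⊕-assoc v a b) (⊕-wrap v eq)

  ⊕-pred-succ : ∀ v → v ⊕ n ⊕ 1 ≡ v
  ⊕-pred-succ v = trans (⊕-⊕-wrap v (+-comm n 1)) (⊕-identityʳ v)

  ⊕-succ-pred : ∀ v → v ⊕ 1 ⊕ n ≡ v
  ⊕-succ-pred v = trans (⊕-⊕-wrap v refl) (⊕-identityʳ v)

  CycleDominates : (Fin (suc n) → Bool) → Set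
  CycleDominates D = ∀ v → T (D v) ⊎ T (D (v ⊕ n)) ⊎ T (D (v ⊕ 1))

  CycleDominates-mono : ∀ {D D' : Fin (suc n) → Bool} → (∀ v → T (D v) → T (D' v)) →
    CycleDominates D → CycleDominates D'
  CycleDominates-mono D⊆D' dom v = Sum.map (D⊆D' _) (Sum.map (D⊆D' _) (D⊆D' _)) (dom v)

  toℕ-⊕-1 : ∀ u → suc (toℕ u) % suc n ≡ toℕ (u ⊕ 1)
  toℕ-⊕-1 u = trans (cong (_% suc n) (+-comm 1 (toℕ u))) (sym (toℕ-⊕ u 1))

  cycleG-adjacent : ∀ u v → T (cycleG (suc n) u v) → v ≡ u ⊕ 1 ⊎ u ≡ v ⊕ 1
  cycleG-adjacent u v adj with ∨-elim {toℕ v ≡ᵇ suc (toℕ u) % suc n} adj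
  ... | inj₁ p = inj₁ (Fin.toℕ-injective (trans (≡ᵇ⇒≡ _ _ p) (toℕ-⊕-1 u)))
  ... | inj₂ p = inj₂ (Fin.toℕ-injective (trans (≡ᵇ⇒≡ _ _ p) (toℕ-⊕-1 v)))

  cycleG-succ : ∀ u → T (cycleG (suc n) u (u ⊕ 1))
  cycleG-succ u = ∨-introˡ (≡⇒≡ᵇ _ _ (sym (toℕ-⊕-1 u)))

  cycleG-pred : ∀ v → T (cycleG (suc n) (v ⊕ 1) v)
  cycleG-pred v = ∨-introʳ {toℕ v ≡ᵇ suc (toℕ (v ⊕ 1)) % suc n} (≡⇒≡ᵇ _ _ (sym (toℕ-⊕-1 v)))

  decode : Fin (suc n) → (k : ℕ) → Subset (suc n ∸ k ∸ 2) → Subset (suc n)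
  decode r k P = tabulate (λ v → layout k P (offset r v))

  decode-unique : ∀ (D : Subset (suc n)) r k P → (∀ a → a < suc n → lookup D (r ⊕ a) ≡ layout k P a) →
    D ≡ decode r k P
  decode-unique D r k P agree = trans (sym (tabulate∘lookup D)) (tabulate-cong λ v →
    trans (cong (lookup D) (sym (⊕-offset r v))) (agree (offset r v) (offset< r v)))

  module _ (S : Subset (suc n)) where

    private
      DominatedAt : Fin (suc n) → Bool
      DominatedAt v = lookup S v ∨ any (λ u → lookup S u ∧ cycleG (suc n) u v) (allFin (suc n))

    isDominating-cycle⁻ : T (isDominating (cycleG (suc n)) S) → CycleDominates (lookup S)
    isDominating-cycle⁻ dom v with ∨-elim {lookup S v} (All.lookup (all⁺ DominatedAt (allFin (suc n)) dom) (∈-allFin v))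
    ... | inj₁ p = inj₁ p
    ... | inj₂ p with Any.satisfied (any⁻ (λ u → lookup S u ∧ cycleG (suc n) u v) (allFin (suc n)) p)
    ... | u , q with ∧-elim {lookup S u} q
    ... | Su , adj with cycleG-adjacent u v adj
    ... | inj₁ refl = inj₂ (inj₁ (subst (T ∘ lookup S) (sym (⊕-succ-pred u)) Su))
    ... | inj₂ refl = inj₂ (inj₂ Su)

    isDominating-cycle⁺ : CycleDominates (lookup S) → T (isDominating (cycleG (suc n)) S)
    isDominating-cycle⁺ dom = all⁻ DominatedAt {allFin (suc n)} (All.tabulate (λ {v} _ → dominated v (dom v)))
      where
      neighbour : ∀ {v} u → T (lookup S u) → T (cycleG (suc n) u v) → T (DominatedAt v)
      neighbour {v} u Su adj = ∨-introʳ {lookup S v}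
        (any⁺ (λ u → lookup S u ∧ cycleG (suc n) u v) (lose (∈-allFin u) (∧-intro {lookup S u} Su adj)))
      dominated : ∀ v → T (lookup S v) ⊎ T (lookup S (v ⊕ n)) ⊎ T (lookup S (v ⊕ 1)) → T (DominatedAt v)
      dominated v (inj₁ p)        = ∨-introˡ p
      dominated v (inj₂ (inj₁ p)) = neighbour (v ⊕ n) p (subst (T ∘ cycleG (suc n) (v ⊕ n)) (⊕-pred-succ v) (cycleG-succ (v ⊕ n)))
      dominated v (inj₂ (inj₂ p)) = neighbour (v ⊕ 1) p (cycleG-pred v)

-- A companion point v is charged to v - 1 if v - 1 ∈ D, and to v + 1 otherwise; a member u is then
-- charged for u + 1 only if u + 1 ∉ D, and for u - 1 only if u - 1 ∉ D but u + 1 ∈ D, so at most once.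
charges≤ : ∀ a b c → ⟦ not c ∧ b ⟧ + ⟦ not a ∧ b ∧ c ⟧ ≤ ⟦ b ⟧
charges≤ false false false = z≤n
charges≤ false false true  = z≤n
charges≤ true  false false = z≤n
charges≤ true  false true  = z≤n
charges≤ false true  false = ≤-refl
charges≤ true  true  false = ≤-refl
charges≤ false true  true  = ≤-refl
charges≤ true  true  true  = z≤n

module _ {n : ℕ} (D : Subset (suc n)) where

  private
    χ : Fin (suc n) → Bool
    χ = lookup D

  Triple : Fin (suc n) → Set
  Triple v = T (χ (v ⊕ n)) × T (χ v) × T (χ (v ⊕ 1))

  NoTriple : Set
  NoTriple = ∀ v → ¬ Triple v

  companionAt : Fin (suc n) → Bool
  companionAt v = not (χ v) ∧ (χ (v ⊕ n) ∨ (χ (v ⊕ 1) ∧ χ (v ⊕ 2)))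

  companion : Subset (suc n)
  companion = tabulate companionAt

  companion-∋ˡ : ∀ {u} → ¬ T (χ u) → T (χ (u ⊕ n)) → T (lookup companion u)
  companion-∋ˡ {u} u∉D p = subst T (sym (lookup∘tabulate companionAt u))
    (∧-intro (not-intro u∉D) (∨-introˡ p))

  companion-∋ʳ : ∀ {u} → ¬ T (χ u) → T (χ (u ⊕ 1)) → T (χ (u ⊕ 2)) → T (lookup companion u)
  companion-∋ʳ {u} u∉D p q = subst T (sym (lookup∘tabulate companionAt u))
    (∧-intro (not-intro u∉D) (∨-introʳ {χ (u ⊕ n)} (∧-intro {χ (u ⊕ 1)} p q)))

  companion-disjoint : Disjoint companion D
  companion-disjoint v p = not-elim (proj₁ (∧-elim {not (χ v)} (subst T (lookup∘tabulate companionAt v) p)))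

  companion-dominates : CycleDominates χ → NoTriple → CycleDominates (lookup companion)
  companion-dominates dom noTriple v with T? (χ v) | T? (χ (v ⊕ n)) | T? (χ (v ⊕ 1))
  ... | no v∉D | yes p     | _         = inj₁ (companion-∋ˡ v∉D p)
  ... | no v∉D | no v-1∉D  | _         = inj₂ (inj₁ (companion-∋ˡ v-1∉D v-2∈D))
    where
    v-2∈D : T (χ (v ⊕ n ⊕ n))
    v-2∈D with dom (v ⊕ n)
    ... | inj₁ p        = ⊥-elim (v-1∉D p)
    ... | inj₂ (inj₁ p) = p
    ... | inj₂ (inj₂ p) = ⊥-elim (v∉D (subst (T ∘ χ) (⊕-pred-succ v) p))
  ... | yes v∈D | _        | no v+1∉D  = inj₂ (inj₂ (companion-∋ˡ v+1∉D (subst (T ∘ χ) (sym (⊕-succ-pred v)) v∈D)))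
  ... | yes v∈D | _        | yes v+1∈D = inj₂ (inj₁ (companion-∋ʳ (λ v-1∈D → noTriple v (v-1∈D , v∈D , v+1∈D))
                                           (subst (T ∘ χ) (sym (⊕-pred-succ v)) v∈D)
                                           (subst (T ∘ χ) (sym (⊕-⊕-wrap v (+-comm n 2))) v+1∈D)))

  companion-card : ∣ companion ∣ ≤ ∣ D ∣
  companion-card = begin
    ∣ companion ∣                                      ≡⟨ card≡sum companion ⟩
    ∑[ v ∈ allFin (suc n) ] ⟦ lookup companion v ⟧
      ≡⟨ sumList-cong (allFin (suc n)) (λ v → cong ⟦_⟧ (lookup∘tabulate companionAt v)) ⟩
    ∑[ v ∈ allFin (suc n) ] ⟦ companionAt v ⟧          ≤⟨ sumList-mono (allFin (suc n)) split ⟩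
    ∑[ v ∈ allFin (suc n) ] (pred∈ v + succ∈ v)         ≡⟨ sumList-+ (allFin (suc n)) pred∈ succ∈ ⟩
    sumList (allFin (suc n)) pred∈ + sumList (allFin (suc n)) succ∈
      ≡⟨ cong₂ _+_ (shift 1 pred∈ (λ u → cong (λ w → ⟦ not (χ (u ⊕ 1)) ∧ χ w ⟧) (⊕-succ-pred u)))
                   (shift n succ∈ (λ u → cong₂ (λ w w' → ⟦ not (χ (u ⊕ n)) ∧ χ w ∧ χ w' ⟧)
                                                 (⊕-pred-succ u) (⊕-⊕-wrap u (+-comm n 2)))) ⟩
    sumList (allFin (suc n)) lastOfRun + sumList (allFin (suc n)) firstOfLongRun
      ≡⟨ sumList-+ (allFin (suc n)) lastOfRun firstOfLongRun ⟨
    ∑[ u ∈ allFin (suc n) ] (lastOfRun u + firstOfLongRun u)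
      ≤⟨ sumList-mono (allFin (suc n)) (λ u → charges≤ (χ (u ⊕ n)) (χ u) (χ (u ⊕ 1))) ⟩
    ∑[ u ∈ allFin (suc n) ] ⟦ χ u ⟧                    ≡⟨ card≡sum D ⟨
    ∣ D ∣                                              ∎
    where
    open ≤-Reasoning
    pred∈ succ∈ : Fin (suc n) → ℕ
    pred∈ v = ⟦ not (χ v) ∧ χ (v ⊕ n) ⟧
    succ∈ v = ⟦ not (χ v) ∧ χ (v ⊕ 1) ∧ χ (v ⊕ 2) ⟧
    lastOfRun firstOfLongRun : Fin (suc n) → ℕ
    lastOfRun u = ⟦ not (χ (u ⊕ 1)) ∧ χ u ⟧
    firstOfLongRun u = ⟦ not (χ (u ⊕ n)) ∧ χ u ∧ χ (u ⊕ 1) ⟧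
    split : ∀ v → ⟦ companionAt v ⟧ ≤ pred∈ v + succ∈ v
    split v = subst (λ b → ⟦ b ⟧ ≤ pred∈ v + succ∈ v) (sym (∧-distribˡ-∨ (not (χ v)) _ _))
                (⟦∨⟧≤ (not (χ v) ∧ χ (v ⊕ n)) _)
    shift : ∀ a (h : Fin (suc n) → ℕ) {h' : Fin (suc n) → ℕ} → (∀ u → h (u ⊕ a) ≡ h' u) →
      sumList (allFin (suc n)) h ≡ sumList (allFin (suc n)) h'
    shift a h eq = trans (sym (sum-⊕-invariant h a)) (sumList-cong (allFin (suc n)) eq)

  companion-padded : ∣ D ∣ + ∣ D ∣ ≤ suc n →
    Σ (Subset (suc n)) λ S → companion ⊆ S × Disjoint S D × ∣ S ∣ ≡ ∣ D ∣
  companion-padded small =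
    let S , c⊆S , S∩D , card = pad companion D (∣ D ∣ ∸ ∣ companion ∣) companion-disjoint
                                 (≤-trans (≤-reflexive (cong (_+ ∣ D ∣) slack+c≡d)) small)
    in S , c⊆S , S∩D , trans card slack+c≡d
    where
    slack+c≡d : ∣ D ∣ ∸ ∣ companion ∣ + ∣ companion ∣ ≡ ∣ D ∣
    slack+c≡d = m∸n+n≡m companion-card

  noTriple⇒¬accurate : CycleDominates χ → NoTriple → ∣ D ∣ + ∣ D ∣ ≤ suc n →
    ¬ T (isAccurate (cycleG (suc n)) D)
  noTriple⇒¬accurate dom noTriple small accurate =
    let S , c⊆S , S∩D , card = companion-padded small
    in accurate⇒noRival (cycleG (suc n)) D accurate S (disjointFrom-intro S D S∩D) card
         (isDominating-cycle⁺ S (CycleDominates-mono c⊆S (companion-dominates dom noTriple)))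

  record MaximalRun (r : Fin (suc n)) (k : ℕ) : Set where
    field
      inside : ∀ a → a < k → T (χ (r ⊕ a))
      after  : ¬ T (χ (r ⊕ k))
      before : ¬ T (χ (r ⊕ n))

  sum-run : ∀ r k → (∀ a → a < k → T (χ (r ⊕ a))) → ∑[ a < k ] ⟦ χ (r ⊕ a) ⟧ ≡ k
  sum-run r k inside = begin
    ∑[ a < k ] ⟦ χ (r ⊕ a) ⟧ ≡⟨ sumBelow-cong k (λ a a<k → T⇒⟦⟧≡1 (inside a a<k)) ⟩
    ∑[ a < k ] 1             ≡⟨ sumBelow-const k 1 ⟩
    k * 1                    ≡⟨ *-identityʳ k ⟩
    k                        ∎
    where open ≡-Reasoning

  run≤card : ∀ r k → k ≤ suc n → (∀ a → a < k → T (χ (r ⊕ a))) → k ≤ ∣ D ∣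
  run≤card r k k≤N inside = begin
    k                                          ≡⟨ sum-run r k inside ⟨
    ∑[ a < k ] ⟦ χ (r ⊕ a) ⟧                   ≤⟨ m≤m+n _ _ ⟩
    ∑[ a < k ] ⟦ χ (r ⊕ a) ⟧ + ∑[ a < suc n ∸ k ] ⟦ χ (r ⊕ (k + a)) ⟧
                                               ≡⟨ sumBelow-+ k (suc n ∸ k) (λ a → ⟦ χ (r ⊕ a) ⟧) ⟨
    ∑[ a < k + (suc n ∸ k) ] ⟦ χ (r ⊕ a) ⟧     ≡⟨ cong (λ L → ∑[ a < L ] ⟦ χ (r ⊕ a) ⟧) (m+[n∸m]≡n k≤N) ⟩
    ∑[ a < suc n ] ⟦ χ (r ⊕ a) ⟧               ≡⟨ card-rotate D r ⟨
    ∣ D ∣                                      ∎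
    where open ≤-Reasoning

  nonMember : 1 ≤ ∣ D ∣ → ∣ D ∣ + ∣ D ∣ ≤ suc n → ∃ λ w → ¬ T (χ w)
  nonMember nonempty small with Fin.any? (λ w → ¬? (T? (χ w)))
  ... | yes found = found
  ... | no none = ⊥-elim (<⇒≱ notFull full)
    where
    notFull : ∣ D ∣ < suc n
    notFull = ≤-trans (≤-reflexive (+-comm 1 ∣ D ∣)) (≤-trans (+-monoʳ-≤ ∣ D ∣ nonempty) small)
    full : suc n ≤ ∣ D ∣
    full = run≤card fzero (suc n) ≤-refl (λ a _ → decidable-stable (T? (χ (fzero ⊕ a))) (λ ¬in → none (_ , ¬in)))

  accurate⇒triple : T (isAccurate (cycleG (suc n)) D) → ∣ D ∣ + ∣ D ∣ ≤ suc n → ∃ Triple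
  accurate⇒triple accurate small with Fin.any? (λ v → T? (χ (v ⊕ n)) ×-dec T? (χ v) ×-dec T? (χ (v ⊕ 1)))
  ... | yes triple = triple
  ... | no noTriple = ⊥-elim (noTriple⇒¬accurate dom (λ v t → noTriple (v , t)) small accurate)
    where
    dom : CycleDominates χ
    dom = isDominating-cycle⁻ D (proj₁ (∧-elim {isDominating (cycleG (suc n)) D} accurate))

  tripleBlock : ∀ w v → Triple v → ∀ x → offset w (v ⊕ n) ≤ x → x ≤ offset w (v ⊕ n) + 2 → T (χ (w ⊕ x))
  tripleBlock w v (v-1∈D , v∈D , v+1∈D) x o≤x x≤o+2 =
    subst (T ∘ χ) (trans (cong (_⊕ (x ∸ o)) (sym (⊕-offset w (v ⊕ n))))
                    (trans (⊕-assoc w o (x ∸ o)) (cong (w ⊕_) (m+[n∸m]≡n o≤x))))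
      (around (x ∸ o) (≤-trans (∸-monoˡ-≤ o x≤o+2) (≤-reflexive (m+n∸m≡n o 2))))
    where
    o : ℕ
    o = offset w (v ⊕ n)
    around : ∀ y → y ≤ 2 → T (χ (v ⊕ n ⊕ y))
    around 0 _ = subst (T ∘ χ) (sym (⊕-identityʳ (v ⊕ n))) v-1∈D
    around 1 _ = subst (T ∘ χ) (sym (⊕-pred-succ v)) v∈D
    around 2 _ = subst (T ∘ χ) (sym (⊕-⊕-wrap v (+-comm n 2))) v+1∈D
    around (suc (suc (suc y))) (s≤s (s≤s ()))

  longRunThrough : ∀ w → ¬ T (χ w) → ∀ v → Triple v → ∃ λ r → ∃ λ k → 3 ≤ k × MaximalRun r k
  longRunThrough w w∉D v triple =
    let j , k , 2<k , _ , ¬fj , ¬fe , run = maximalRun (λ a → χ (w ⊕ a))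
          (w∉D ∘ subst (T ∘ χ) (⊕-identityʳ w))
          (w∉D ∘ subst (T ∘ χ) (trans (⊕-wrap w {suc n} {0} refl) (⊕-identityʳ w)))
          (<⇒≤ (offset< w (v ⊕ n))) (tripleBlock w v triple)
    in w ⊕ suc j , k , 2<k , record
      { inside = λ a a<k → subst (T ∘ χ) (sym (⊕-assoc w (suc j) a)) (run a a<k)
      ; after  = ¬fe ∘ subst (T ∘ χ) (⊕-assoc w (suc j) k)
      ; before = ¬fj ∘ subst (T ∘ χ) (trans (⊕-assoc w (suc j) n) (⊕-wrap w (sym (+-suc j n))))
      }

  MaximalRun⇒≤ : ∀ {r k} → MaximalRun r k → k ≤ n
  MaximalRun⇒≤ {r} {k} run with k ≤? n
  ... | yes k≤n = k≤n
  ... | no k≰n = ⊥-elim (MaximalRun.before run (MaximalRun.inside run n (≰⇒> k≰n)))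

  accurate⇒longRun : T (isAccurate (cycleG (suc n)) D) → 1 ≤ ∣ D ∣ → ∣ D ∣ + ∣ D ∣ ≤ suc n →
    ∃ λ r → ∃ λ k → 3 ≤ k × MaximalRun r k
  accurate⇒longRun accurate nonempty small =
    let v , triple = accurate⇒triple accurate small
        w , w∉D    = nonMember nonempty small
    in longRunThrough w w∉D v triple

module Decomposition {n : ℕ} (D : Subset (suc n)) {r : Fin (suc n)} {k : ℕ}
                     (run : MaximalRun D r k) (fits : k + 2 ≤ suc n) where

  open MaximalRun run

  private
    χ : Fin (suc n) → Bool
    χ = lookup D

  m : ℕ
  m = suc n ∸ k ∸ 2

  k+1+m≡n : k + suc m ≡ n
  k+1+m≡n = suc-injective (begin
    suc (k + suc m)           ≡⟨ rearrange k m ⟩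
    k + 2 + m                 ≡⟨ cong (k + 2 +_) (∸-+-assoc (suc n) k 2) ⟩
    k + 2 + (suc n ∸ (k + 2)) ≡⟨ m+[n∸m]≡n fits ⟩
    suc n                     ∎)
    where
    open ≡-Reasoning
    rearrange : ∀ k m → suc (k + suc m) ≡ k + 2 + m
    rearrange = solve-∀

  tail : Subset m
  tail = tabulate (λ u → χ (r ⊕ (k + suc (toℕ u))))

  lookup₀-tail : ∀ t → t < m → lookup₀ tail t ≡ χ (r ⊕ (k + suc t))
  lookup₀-tail t t<m = trans (lookup₀-tabulate _ t t<m) (cong (λ x → χ (r ⊕ (k + suc x))) (Fin.toℕ-fromℕ< t<m))

  layout-agrees : ∀ a → a < suc n → χ (r ⊕ a) ≡ layout k tail a
  layout-agrees a a<N with a <? k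
  ... | yes a<k = trans (T⇒≡true (inside a a<k)) (sym (layout-run k tail a a<k))
  ... | no a≮k = begin
    χ (r ⊕ a)                 ≡⟨ cong (χ ∘ (r ⊕_)) k+b≡a ⟨
    χ (r ⊕ (k + (a ∸ k)))     ≡⟨ beyondRun (a ∸ k) (subst (_< suc n) (sym k+b≡a) a<N) ⟩
    lookup₀ (false ∷ tail) (a ∸ k) ≡⟨ layout-after k tail (a ∸ k) ⟨
    layout k tail (k + (a ∸ k)) ≡⟨ cong (layout k tail) k+b≡a ⟩
    layout k tail a           ∎
    where
    open ≡-Reasoning
    k+b≡a : k + (a ∸ k) ≡ a
    k+b≡a = m+[n∸m]≡n (≮⇒≥ a≮k)
    beyondRun : ∀ b → k + b < suc n → χ (r ⊕ (k + b)) ≡ lookup₀ (false ∷ tail) b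
    beyondRun zero    _ = ¬T⇒≡false (after ∘ subst (T ∘ χ) (cong (r ⊕_) (+-identityʳ k)))
    beyondRun (suc t) k+b<N with t <? m
    ... | yes t<m = sym (lookup₀-tail t t<m)
    ... | no t≮m = trans (¬T⇒≡false (before ∘ subst (T ∘ χ) (cong (r ⊕_) (trans (cong (λ x → k + suc x) t≡m) k+1+m≡n))))
                         (sym (lookup₀-beyond tail t (≮⇒≥ t≮m)))
      where
      t≡m : t ≡ m
      t≡m = ≤-antisym (s≤s⁻¹ (+-cancelˡ-≤ k (suc t) (suc m) (≤-trans (s≤s⁻¹ k+b<N) (≤-reflexive (sym k+1+m≡n)))))
                      (≮⇒≥ t≮m)

  D≡decode : D ≡ decode r k tail
  D≡decode = decode-unique D r k tail layout-agrees

  card-tail : ∣ tail ∣ ≡ ∑[ c < m ] ⟦ χ (r ⊕ (k + suc c)) ⟧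
  card-tail = trans (card≡sum tail) (sumFin-sumBelow (λ u → ⟦ lookup tail u ⟧) (λ c → ⟦ χ (r ⊕ (k + suc c)) ⟧)
    (λ u → cong ⟦_⟧ (lookup∘tabulate (λ u → χ (r ⊕ (k + suc (toℕ u)))) u)))

  card-D : ∣ D ∣ ≡ k + ∣ tail ∣
  card-D = begin
    ∣ D ∣                                              ≡⟨ card-rotate D r ⟩
    sumBelow (suc n) h                                 ≡⟨ cong (λ L → sumBelow L h) N≡k+1+m+1 ⟩
    sumBelow (k + (1 + (m + 1))) h                     ≡⟨ sumBelow-+ k (1 + (m + 1)) h ⟩
    sumBelow k h + (h (k + 0) + ∑[ c < m + 1 ] h (k + suc c))
      ≡⟨ cong₂ (λ x y → x + (y + ∑[ c < m + 1 ] h (k + suc c))) (sum-run D r k inside) (gap (+-identityʳ k) after) ⟩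
    k + ∑[ c < m + 1 ] h (k + suc c)                   ≡⟨ cong (k +_) (sumBelow-+ m 1 (λ c → h (k + suc c))) ⟩
    k + (∑[ c < m ] h (k + suc c) + (h (k + suc (m + 0)) + 0))
                                                       ≡⟨ cong (λ x → k + (∑[ c < m ] h (k + suc c) + (x + 0)))
                                                               (gap (trans (cong (λ x → k + suc x) (+-identityʳ m)) k+1+m≡n) before) ⟩
    k + (∑[ c < m ] h (k + suc c) + 0)                 ≡⟨ cong (k +_) (trans (+-identityʳ _) (sym card-tail)) ⟩
    k + ∣ tail ∣                                       ∎
    where
    open ≡-Reasoning
    h : ℕ → ℕ
    h a = ⟦ χ (r ⊕ a) ⟧
    N≡k+1+m+1 : suc n ≡ k + (1 + (m + 1))
    N≡k+1+m+1 = trans (cong suc (sym k+1+m≡n)) (trans (sym (+-suc k (suc m))) (cong (λ x → k + suc x) (+-comm 1 m)))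
    gap : ∀ {a b} → a ≡ b → ¬ T (χ (r ⊕ b)) → h a ≡ 0
    gap refl ¬in = ¬T⇒⟦⟧≡0 ¬in

  tail-dominates : CycleDominates χ → T (isDominating (pathG m) tail)
  tail-dominates dom = isDominating-path⁺ m (λ a → χ (r ⊕ (k + a)))
    (after ∘ subst (T ∘ χ) (cong (r ⊕_) (+-identityʳ k)))
    (before ∘ subst (T ∘ χ) (cong (r ⊕_) k+1+m≡n))
    (λ t _ → Sum.map₂ (Sum.map (subst (T ∘ χ) (predecessor t)) (subst (T ∘ χ) (successor t))) (dom (r ⊕ (k + suc t))))
    where
    predecessor : ∀ t → r ⊕ (k + suc t) ⊕ n ≡ r ⊕ (k + t)
    predecessor t = trans (⊕-assoc r (k + suc t) n) (⊕-wrap r (shuffle k t n))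
      where
      shuffle : ∀ k t n → k + suc t + n ≡ k + t + suc n
      shuffle = solve-∀
    successor : ∀ t → r ⊕ (k + suc t) ⊕ 1 ≡ r ⊕ (k + suc (suc t))
    successor t = trans (⊕-assoc r (k + suc t) 1) (cong (r ⊕_) (shuffle k t))
      where
      shuffle : ∀ k t → k + suc t + 1 ≡ k + suc (suc t)
      shuffle = solve-∀

module Counting {n : ℕ} (i : ℕ) (3≤i : 3 ≤ i) (small : i + i ≤ suc n) where

  goodTail : (k : ℕ) → Subset (suc n ∸ k ∸ 2) → Bool
  goodTail k P = isDominating (pathG (suc n ∸ k ∸ 2)) P ∧ (∣ P ∣ ≡ᵇ i ∸ k)

  codeOfRun : ∀ D {r k} → CycleDominates (lookup D) → MaximalRun D r k → ∣ D ∣ ≡ i →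
    k ≤ i ∸ 1 × Σ (Subset (suc n ∸ k ∸ 2)) λ P → T (goodTail k P) × D ≡ decode r k P
  codeOfRun D {r} {k} dom run |D|≡i = k≤i∸1 , tail , ∧-intro (tail-dominates dom) (≡⇒≡ᵇ _ _ |tail|≡i∸k) , D≡decode
    where
    k≤i : k ≤ i
    k≤i = subst (k ≤_) |D|≡i (run≤card D r k (≤-trans (MaximalRun⇒≤ D run) (n≤1+n n)) (MaximalRun.inside run))
    k+3≤N : k + 3 ≤ suc n
    k+3≤N = ≤-trans (+-monoˡ-≤ 3 k≤i) (≤-trans (+-monoʳ-≤ i 3≤i) small)
    fits : k + 2 ≤ suc n
    fits = ≤-trans (+-monoʳ-≤ k (n≤1+n 2)) k+3≤N
    open Decomposition D run fits
    i≡k+|tail| : i ≡ k + ∣ tail ∣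
    i≡k+|tail| = trans (sym |D|≡i) card-D
    |tail|≡i∸k : ∣ tail ∣ ≡ i ∸ k
    |tail|≡i∸k = sym (trans (cong (_∸ k) i≡k+|tail|) (m+n∸m≡n k ∣ tail ∣))
    0<m : 0 < m
    0<m = subst (0 <_) (sym (∸-+-assoc (suc n) k 2)) (m<n⇒0<n∸m (≤-trans (≤-reflexive (sym (+-suc k 2))) k+3≤N))
    k≤i∸1 : k ≤ i ∸ 1
    k≤i∸1 = subst (λ x → k ≤ x ∸ 1) (sym i≡k+|tail|)
      (≤-trans (≤-reflexive (sym (m+n∸n≡m k 1)))
        (∸-monoˡ-≤ 1 (+-monoʳ-≤ k (dominating⇒nonempty (pathG m) tail 0<m (tail-dominates dom)))))

  accurate⇒code : ∀ D → T (isAccurate (cycleG (suc n)) D) → ∣ D ∣ ≡ i →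
    ∃ λ r → ∃ λ k → 3 ≤ k × k ≤ i ∸ 1 × Σ (Subset (suc n ∸ k ∸ 2)) λ P → T (goodTail k P) × D ≡ decode r k P
  accurate⇒code D accurate |D|≡i =
    let r , k , 3≤k , run = accurate⇒longRun D accurate nonempty (subst (λ x → x + x ≤ suc n) (sym |D|≡i) small)
    in r , k , 3≤k , codeOfRun D dom run |D|≡i
    where
    nonempty : 1 ≤ ∣ D ∣
    nonempty = subst (1 ≤_) (sym |D|≡i) (≤-trans (s≤s z≤n) 3≤i)
    dom : CycleDominates (lookup D)
    dom = isDominating-cycle⁻ D (proj₁ (∧-elim {isDominating (cycleG (suc n)) D} accurate))

  codes : ℕ → Subset (suc n) → ℕ
  codes k D = ∑[ r ∈ allFin (suc n) ] ∑[ P ∈ allSubsets (suc n ∸ k ∸ 2) ] ⟦ goodTail k P ∧ does (D ≟ˢ decode r k P) ⟧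

  sum-codes : ∀ k → ∑[ D ∈ allSubsets (suc n) ] codes k D ≡ suc n * d (pathG (suc n ∸ k ∸ 2)) (i ∸ k)
  sum-codes k = begin
    ∑[ D ∈ allSubsets (suc n) ] codes k D
      ≡⟨ sumList-swap (allSubsets (suc n)) (allFin (suc n)) _ ⟩
    ∑[ r ∈ allFin (suc n) ] ∑[ D ∈ allSubsets (suc n) ] ∑[ P ∈ tails ] ⟦ goodTail k P ∧ does (D ≟ˢ decode r k P) ⟧
      ≡⟨ sumList-cong (allFin (suc n)) (λ r → sumList-swap (allSubsets (suc n)) tails _) ⟩
    ∑[ r ∈ allFin (suc n) ] ∑[ P ∈ tails ] ∑[ D ∈ allSubsets (suc n) ] ⟦ goodTail k P ∧ does (D ≟ˢ decode r k P) ⟧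
      ≡⟨ sumList-cong (allFin (suc n)) (λ r → sumList-cong tails (λ P → decodes-once (goodTail k P) (decode r k P))) ⟩
    ∑[ r ∈ allFin (suc n) ] ∑[ P ∈ tails ] ⟦ goodTail k P ⟧
      ≡⟨ sumFin-sumBelow {suc n} _ (λ _ → ∑[ P ∈ tails ] ⟦ goodTail k P ⟧) (λ _ → refl) ⟩
    ∑[ _ < suc n ] ∑[ P ∈ tails ] ⟦ goodTail k P ⟧
      ≡⟨ sumBelow-const (suc n) _ ⟩
    suc n * ∑[ P ∈ tails ] ⟦ goodTail k P ⟧
      ≡⟨ cong (suc n *_) (length-filterᵇ (goodTail k) tails) ⟨
    suc n * d (pathG (suc n ∸ k ∸ 2)) (i ∸ k) ∎
    where
    open ≡-Reasoning
    tails : List (Subset (suc n ∸ k ∸ 2))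
    tails = allSubsets (suc n ∸ k ∸ 2)
    decodes-once : ∀ b (S : Subset (suc n)) → ∑[ D ∈ allSubsets (suc n) ] ⟦ b ∧ does (D ≟ˢ S) ⟧ ≡ ⟦ b ⟧
    decodes-once true  S = count-≡-allSubsets S
    decodes-once false S = sumList-zero (allSubsets (suc n))

  window : ℕ
  window = suc (i ∸ 1) ∸ 3

  accurate≤codes : ∀ D → ⟦ isAccurate (cycleG (suc n)) D ∧ (∣ D ∣ ≡ᵇ i) ⟧ ≤ ∑[ t ∈ upTo window ] codes (3 + t) D
  accurate≤codes D = ⟦⟧≤ (isAccurate (cycleG (suc n)) D ∧ (∣ D ∣ ≡ᵇ i)) λ counted →
    let accurate , size = ∧-elim {isAccurate (cycleG (suc n)) D} counted
        r , k , 3≤k , k≤i∸1 , P , good , D≡ = accurate⇒code D accurate (≡ᵇ⇒≡ _ _ size)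
        term : Subset (suc n ∸ k ∸ 2) → ℕ
        term P = ⟦ goodTail k P ∧ does (D ≟ˢ decode r k P) ⟧
    in begin
      1
        ≡⟨ T⇒⟦⟧≡1 (∧-intro {goodTail k P} good (subst T (sym (dec-true (D ≟ˢ decode r k P) D≡)) _)) ⟨
      term P
        ≤⟨ sumList-∈ term (∈-allSubsets P) ⟩
      sumList (allSubsets (suc n ∸ k ∸ 2)) term
        ≤⟨ sumList-∈ (λ r → ∑[ P ∈ allSubsets (suc n ∸ k ∸ 2) ] ⟦ goodTail k P ∧ does (D ≟ˢ decode r k P) ⟧) (∈-allFin r) ⟩
      codes k D
        ≡⟨ cong (λ k → codes k D) (m+[n∸m]≡n 3≤k) ⟨
      codes (3 + (k ∸ 3)) D
        ≤⟨ sumList-∈ (λ t → codes (3 + t) D) (∈-upTo⁺ (∸-monoˡ-< (s≤s k≤i∸1) 3≤k)) ⟩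
      ∑[ t ∈ upTo window ] codes (3 + t) D
        ∎
    where open ≤-Reasoning

  dₐ≤ : dₐ (cycleG (suc n)) i ≤ sumFromTo 3 (i ∸ 1) (λ k → suc n * d (pathG (suc n ∸ k ∸ 2)) (i ∸ k))
  dₐ≤ = begin
    dₐ (cycleG (suc n)) i
      ≡⟨ length-filterᵇ (λ D → isAccurate (cycleG (suc n)) D ∧ (∣ D ∣ ≡ᵇ i)) (allSubsets (suc n)) ⟩
    ∑[ D ∈ allSubsets (suc n) ] ⟦ isAccurate (cycleG (suc n)) D ∧ (∣ D ∣ ≡ᵇ i) ⟧
      ≤⟨ sumList-mono (allSubsets (suc n)) accurate≤codes ⟩
    ∑[ D ∈ allSubsets (suc n) ] ∑[ t ∈ upTo window ] codes (3 + t) D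
      ≡⟨ sumList-swap (allSubsets (suc n)) (upTo window) (λ D t → codes (3 + t) D) ⟩
    ∑[ t ∈ upTo window ] ∑[ D ∈ allSubsets (suc n) ] codes (3 + t) D
      ≡⟨ sumList-cong (upTo window) (λ t → sum-codes (3 + t)) ⟩
    sumFromTo 3 (i ∸ 1) (λ k → suc n * d (pathG (suc n ∸ k ∸ 2)) (i ∸ k)) ∎
    where open ≤-Reasoning

theorem4p5 : (n i : ℕ) → 6 ≤ n → n / 3 + 2 ≤ i → i ≤ n / 2 →
    dₐ (cycleG n) i ≤ sumFromTo 3 (i ∸ 1) (λ k → n * d (pathG (n ∸ k ∸ 2)) (i ∸ k))
theorem4p5 (suc n) i 6≤n n/3+2≤i i≤n/2 = Counting.dₐ≤ i 3≤i i+i≤n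
  where
  3≤i : 3 ≤ i
  3≤i = ≤-trans (n≤1+n 3) (≤-trans (+-monoˡ-≤ 2 (/-mono-≤ {o = 3} 6≤n ≤-refl)) n/3+2≤i)
  i+i≤n : i + i ≤ suc n
  i+i≤n = begin
    i + i           ≡⟨ cong (i +_) (sym (+-identityʳ i)) ⟩
    2 * i           ≡⟨ *-comm 2 i ⟩
    i * 2           ≤⟨ *-monoˡ-≤ 2 i≤n/2 ⟩
    suc n / 2 * 2   ≤⟨ m/n*n≤m (suc n) 2 ⟩
    suc n           ∎
    where open ≤-Reasoning
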